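{- Every even weakly $\varphi$-practical number is practical.
   Context: A positive integer $n$ is practical if every integer $m$ with $1\le m\le n$ can be written as a sum of distinct positive divisors of $n$. Write $n=p_1^{e_1}\cdots p_k^{e_k}$ with primes $p_1<\cdots<p_k$ and $e_i\ge1$, and set $m_i=p_1^{e_1}\cdots p_i^{e_i}$ for $i=0,\dots,k-1$ (so $m_0=1$). The integer $n$ is weakly $\varphi$-practical if $p_{i+1}\le m_i+2$ for every $i=0,\dots,k-1$. -}

module Defs where

open import Data.Nat using (ℕ; _+_; _*_; _^_; _≤_; _<_)
open import Data.Nat.Divisibility using (_∣_)
open import Data.Nat.Primality using (Prime)
open import Data.List using (List; []; _∷_; map)
open import Data.Nat.ListAction using (sum; product)
open import Data.List.Relation.Unary.All using (All)
open import Data.List.Relation.Unary.Linked using (Linked)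
open import Data.List.Relation.Unary.Unique.Propositional using (Unique)
open import Data.Product using (Σ; ∃; _×_; _,_; proj₁; proj₂)
open import Data.Unit using (⊤)
open import Relation.Binary.PropositionalEquality using (_≡_)

Practical : ℕ → Set
Practical n =
  1 ≤ n ×
  ((m : ℕ) → 1 ≤ m → m ≤ n →
    Σ (List ℕ) λ ds → Unique ds × All (λ d → 1 ≤ d × d ∣ n) ds × sum ds ≡ m)

primePowerProduct : List (ℕ × ℕ) → ℕ
primePowerProduct fs = product (map (λ pe → proj₁ pe ^ proj₂ pe) fs)

IsPrimeFactorization : ℕ → List (ℕ × ℕ) → Set
IsPrimeFactorization n fs =
  All (λ pe → Prime (proj₁ pe) × 1 ≤ proj₂ pe) fs ×
  Linked (λ a b → proj₁ a < proj₁ b) fs ×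
  primePowerProduct fs ≡ n

-- WeakCond m fs: with m = m_i the product of the prime powers already
-- processed, each next prime p_{i+1} satisfies p_{i+1} ≤ m_i + 2.
WeakCond : ℕ → List (ℕ × ℕ) → Set
WeakCond m [] = ⊤
WeakCond m ((p , e) ∷ fs) = p ≤ m + 2 × WeakCond (m * p ^ e) fs

WeaklyPhiPractical : ℕ → Set
WeaklyPhiPractical n =
  1 ≤ n × Σ (List (ℕ × ℕ)) λ fs → IsPrimeFactorization n fs × WeakCond 1 fs

-- Say n represents up to L if each t ≤ L is a sum of distinct positive
-- divisors of n.  The engine is the classical extension step (Stewart,
-- Sierpiński): if m represents up to L, p ∤ m and p ≤ L + 1, then m·pᵉ
-- represents up to L(1 + p + ⋯ + pᵉ); such a t is p·a + b with a in the range
-- of m·pᵉ⁻¹ and b ≤ L, and the two sets of divisors are disjoint as p ∤ m.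
--
-- For n = 2^e₁ p₂^e₂ ⋯ p_k^e_k we start from 1, which represents up to 1,
-- apply the step to 2^e₁ and then to each further prime power, keeping the
-- invariant m_i < L_i; the weak condition p_{i+1} ≤ m_i + 2 then gives the
-- step's hypothesis p_{i+1} ≤ L_i + 1.  Evenness makes the first prime 2.
module Submission where

open import Defs
open import Data.Nat using (ℕ; zero; suc; _+_; _*_; _^_; _≤_; _<_; _∸_; z≤n; s≤s; NonZero; nonTrivial⇒≢1; nonTrivial⇒n>1; >-nonZero⁻¹)
open import Data.Nat.Properties
open import Data.Nat.Divisibility using (_∣_; ∣-trans; ∣-refl; ∣m⇒∣m*n; ∣n⇒∣m*n; *-monoʳ-∣; ∣1⇒≡1; divides)
open import Data.Nat.DivMod using (_/_; _%_; m%n<n; m≡m%n+[m/n]*n; m<n*o⇒m/o<n)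
open import Data.Nat.Primality using (Prime; prime[2]; prime⇒nonZero; prime⇒nonTrivial; prime⇒irreducible; euclidsLemma)
open import Data.Nat.ListAction using (sum)
open import Data.Nat.ListAction.Properties using (sum-++)
open import Algebra.Properties.CommutativeSemigroup *-commutativeSemigroup using (x∙yz≈y∙xz)
open import Data.List using (List; []; _∷_; map; _++_)
open import Data.List.Relation.Unary.All as All using (All; []; _∷_)
import Data.List.Relation.Unary.All.Properties as All
open import Data.List.Relation.Unary.Linked using (Linked)
open import Data.List.Relation.Unary.AllPairs using (AllPairs; []; _∷_)
open import Data.List.Relation.Unary.Linked.Properties using (Linked⇒AllPairs)
open import Data.List.Relation.Unary.Unique.Propositional using (Unique)
import Data.List.Relation.Unary.Unique.Propositional.Properties as Unique
open import Data.List.Membership.Propositional using (_∈_)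
open import Data.List.Membership.Propositional.Properties using (∈-map⁻)
open import Data.Product using (Σ; _×_; _,_; proj₁; proj₂)
open import Data.Sum using (inj₁; inj₂)
open import Function using (_on_)
open import Relation.Nullary using (¬_; yes; no; contradiction)
open import Relation.Binary.PropositionalEquality

DivisorSum : ℕ → ℕ → Set
DivisorSum n t =
  Σ (List ℕ) λ ds → Unique ds × All (λ d → 1 ≤ d × d ∣ n) ds × sum ds ≡ t

RepresentsUpTo : ℕ → ℕ → Set
RepresentsUpTo n L = (t : ℕ) → t ≤ L → DivisorSum n t

representsUpTo-mono : ∀ {n L L′} → L′ ≤ L → RepresentsUpTo n L → RepresentsUpTo n L′
representsUpTo-mono L′≤L rep t t≤L′ = rep t (≤-trans t≤L′ L′≤L)

one-representsUpTo-one : RepresentsUpTo 1 1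
one-representsUpTo-one zero _ = [] , [] , [] , refl
one-representsUpTo-one (suc zero) _ = 1 ∷ [] , [] ∷ [] , (≤-refl , ∣-refl) ∷ [] , refl
one-representsUpTo-one (suc (suc t)) (s≤s ())

geomSum : ℕ → ℕ → ℕ → ℕ
geomSum L p zero = L
geomSum L p (suc e) = L + p * geomSum L p e

geomSum-≥ : ∀ L p e → L * p ^ e ≤ geomSum L p e
geomSum-≥ L p zero = ≤-reflexive (*-identityʳ L)
geomSum-≥ L p (suc e) = begin
  L * (p * p ^ e)        ≡⟨ x∙yz≈y∙xz L p (p ^ e) ⟩
  p * (L * p ^ e)        ≤⟨ *-monoʳ-≤ p (geomSum-≥ L p e) ⟩
  p * geomSum L p e      ≤⟨ m≤n+m _ L ⟩
  L + p * geomSum L p e  ∎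
  where open ≤-Reasoning

-- The invariant m < L survives a step with a positive exponent:
-- m·p^(e+1) < L(1 + ⋯ + p^(e+1)) as soon as m ≤ L and L ≥ 1.
geomSum-> : ∀ {m L} p e → 1 ≤ L → m ≤ L → m * p ^ suc e < geomSum L p (suc e)
geomSum-> {m} {L} p e 1≤L m≤L = begin-strict
  m * (p * p ^ e)        ≡⟨ x∙yz≈y∙xz m p (p ^ e) ⟩
  p * (m * p ^ e)        ≤⟨ *-monoʳ-≤ p (*-monoˡ-≤ (p ^ e) m≤L) ⟩
  p * (L * p ^ e)        ≤⟨ *-monoʳ-≤ p (geomSum-≥ L p e) ⟩
  p * geomSum L p e      <⟨ m<n+m _ 1≤L ⟩
  L + p * geomSum L p e  ∎
  where open ≤-Reasoning

-- Every t ≤ L + p·A is p·a + b with a ≤ A and b ≤ L, provided p ≤ L + 1: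
-- take a = A if t ≥ p·A, and otherwise divide t by p with remainder.
split-below : ∀ {p L A t} .{{_ : NonZero p}} → p ≤ suc L → t ≤ L + p * A →
              Σ ℕ λ a → Σ ℕ λ b → a ≤ A × b ≤ L × p * a + b ≡ t
split-below {p} {L} {A} {t} p≤1+L t≤ with p * A ≤? t
... | yes pA≤t = A , t ∸ p * A , ≤-refl ,
      m≤n+o⇒m∸n≤o t (p * A) (subst (t ≤_) (+-comm L (p * A)) t≤) , m+[n∸m]≡n pA≤t
... | no pA≰t = t / p , t % p , <⇒≤ t/p<A , ≤-pred (≤-trans (m%n<n t p) p≤1+L) , division
  where
  t/p<A : t / p < A
  t/p<A = m<n*o⇒m/o<n (subst (t <_) (*-comm p A) (≰⇒> pA≰t))
  division : p * (t / p) + t % p ≡ t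
  division = begin
    p * (t / p) + t % p  ≡⟨ +-comm _ (t % p) ⟩
    t % p + p * (t / p)  ≡⟨ cong (t % p +_) (*-comm p (t / p)) ⟩
    t % p + t / p * p    ≡⟨ m≡m%n+[m/n]*n t p ⟨
    t                    ∎
    where open ≡-Reasoning

sum-map-scale : ∀ p ds → sum (map (p *_) ds) ≡ p * sum ds
sum-map-scale p [] = sym (*-zeroʳ p)
sum-map-scale p (d ∷ ds) =
  trans (cong (p * d +_) (sum-map-scale p ds)) (sym (*-distribˡ-+ p d (sum ds)))

-- Scaling a representation of a by divisors of k by p, and appending a
-- representation of b by divisors of m, represents p·a + b by divisors of
-- p·k; the two parts are disjoint because every element of the first is a
-- multiple of p while p ∤ m.
join-scaled : ∀ {p k m a b} .{{_ : NonZero p}} → ¬ p ∣ m → m ∣ p * k →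
              DivisorSum k a → DivisorSum m b → DivisorSum (p * k) (p * a + b)
join-scaled {p} {k} {m} p∤m m∣pk (xs , xs-unique , xs-div , xs-sum) (ys , ys-unique , ys-div , ys-sum) =
  map (p *_) xs ++ ys ,
  Unique.++⁺ (Unique.map⁺ (λ {x} {y} → *-cancelˡ-≡ x y p) xs-unique) ys-unique disjoint ,
  All.++⁺ (All.map⁺ (All.map scaled xs-div)) (All.map (λ (1≤d , d∣m) → 1≤d , ∣-trans d∣m m∣pk) ys-div) ,
  trans (sum-++ (map (p *_) xs) ys) (cong₂ _+_ (trans (sum-map-scale p xs) (cong (p *_) xs-sum)) ys-sum)
  where
  scaled : ∀ {d} → 1 ≤ d × d ∣ k → 1 ≤ p * d × p * d ∣ p * k
  scaled (1≤d , d∣k) = *-mono-≤ (>-nonZero⁻¹ p) 1≤d , *-monoʳ-∣ p d∣k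
  disjoint : ∀ {v} → ¬ (v ∈ map (p *_) xs × v ∈ ys)
  disjoint (v∈pxs , v∈ys) with ∈-map⁻ (p *_) v∈pxs
  ... | x , _ , refl = p∤m (∣-trans (divides x (*-comm p x)) (proj₂ (All.lookup ys-div v∈ys)))

extend-by-prime-power : ∀ {m L p} .{{_ : NonZero p}} → ¬ p ∣ m → p ≤ suc L →
  RepresentsUpTo m L → ∀ e → RepresentsUpTo (m * p ^ e) (geomSum L p e)
extend-by-prime-power {m} {L} {p} p∤m p≤1+L rep zero =
  subst (λ k → RepresentsUpTo k L) (sym (*-identityʳ m)) rep
extend-by-prime-power {m} {L} {p} p∤m p≤1+L rep (suc e) t t≤ =
  let a , b , a≤ , b≤ , t≡ = split-below p≤1+L t≤
      sum-pk = join-scaled p∤m (∣n⇒∣m*n p (∣m⇒∣m*n (p ^ e) ∣-refl))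
                 (extend-by-prime-power p∤m p≤1+L rep e a a≤) (rep b b≤)
  in subst₂ DivisorSum (x∙yz≈y∙xz p m (p ^ e)) t≡ sum-pk

prime∤1 : ∀ {q} → Prime q → ¬ q ∣ 1
prime∤1 q-prime q∣1 = nonTrivial⇒≢1 {{prime⇒nonTrivial q-prime}} (∣1⇒≡1 q∣1)

prime∤* : ∀ {q m n} → Prime q → ¬ q ∣ m → ¬ q ∣ n → ¬ q ∣ m * n
prime∤* {q} {m} {n} q-prime q∤m q∤n q∣mn with euclidsLemma m n q-prime q∣mn
... | inj₁ q∣m = q∤m q∣m
... | inj₂ q∣n = q∤n q∣n

prime∤prime^ : ∀ {q p} → Prime q → Prime p → q ≢ p → ∀ e → ¬ q ∣ p ^ e
prime∤prime^ q-prime p-prime q≢p zero = prime∤1 q-prime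
prime∤prime^ q-prime p-prime q≢p (suc e) =
  prime∤* q-prime q∤p (prime∤prime^ q-prime p-prime q≢p e)
  where
  q∤p : ¬ _ ∣ _
  q∤p q∣p with prime⇒irreducible p-prime q∣p
  ... | inj₁ q≡1 = nonTrivial⇒≢1 {{prime⇒nonTrivial q-prime}} q≡1
  ... | inj₂ q≡p = q≢p q≡p

PrimePower : ℕ × ℕ → Set
PrimePower pe = Prime (proj₁ pe) × 1 ≤ proj₂ pe

Increasing : ℕ × ℕ → ℕ × ℕ → Set
Increasing = _<_ on proj₁

prime∤primePowerProduct : ∀ {q} fs → Prime q → All PrimePower fs →
  All (λ pe → q < proj₁ pe) fs → ¬ q ∣ primePowerProduct fs
prime∤primePowerProduct [] q-prime _ _ = prime∤1 q-prime
prime∤primePowerProduct ((p , e) ∷ fs) q-prime ((p-prime , _) ∷ pps) (q<p ∷ q<fs) =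
  prime∤* q-prime (prime∤prime^ q-prime p-prime (<⇒≢ q<p) e)
    (prime∤primePowerProduct fs q-prime pps q<fs)

least-prime-divisor : ∀ {q p e fs} → Prime q → q ∣ primePowerProduct ((p , e) ∷ fs) →
  All PrimePower ((p , e) ∷ fs) → AllPairs Increasing ((p , e) ∷ fs) → p ≤ q
least-prime-divisor {q} {p} {e} {fs} q-prime q∣n pps (p<fs ∷ _) = ≮⇒≥ q≮p
  where
  q≮p : ¬ q < p
  q≮p q<p = prime∤primePowerProduct ((p , e) ∷ fs) q-prime pps
              (q<p ∷ All.map (<-trans q<p) p<fs) q∣n

later-primes-∤ : ∀ {m p} e fs → Prime p → All PrimePower fs →
  All (Increasing (p , e)) fs → All (λ pe → ¬ proj₁ pe ∣ m) fs →
  All (λ pe → ¬ proj₁ pe ∣ m * p ^ e) fs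
later-primes-∤ e [] _ _ _ _ = []
later-primes-∤ e (_ ∷ fs) p-prime ((q-prime , _) ∷ pps) (p<q ∷ p<fs) (q∤m ∷ fs∤m) =
  prime∤* q-prime q∤m (prime∤prime^ q-prime p-prime (≢-sym (<⇒≢ p<q)) e)
    ∷ later-primes-∤ e fs p-prime pps p<fs fs∤m

-- The invariant
-- m < L turns the weak condition p ≤ m + 2 into the step's hypothesis
-- p ≤ L + 1, and geomSum-> restores it afterwards.
extend-along : ∀ fs {m L} → RepresentsUpTo m L → m < L →
  All PrimePower fs → AllPairs Increasing fs → All (λ pe → ¬ proj₁ pe ∣ m) fs →
  WeakCond m fs → RepresentsUpTo (m * primePowerProduct fs) (m * primePowerProduct fs)
extend-along [] {m} rep m<L _ _ _ _ =
  subst (λ k → RepresentsUpTo k k) (sym (*-identityʳ m)) (representsUpTo-mono (<⇒≤ m<L) rep)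
extend-along ((p , suc e) ∷ fs) {m} {L} rep m<L ((p-prime , _) ∷ pps) (p<fs ∷ incr) (p∤m ∷ fs∤m) (p≤m+2 , weak) =
  subst (λ k → RepresentsUpTo k k) (*-assoc m (p ^ suc e) (primePowerProduct fs))
    (extend-along fs rep′ (geomSum-> p e (≤-<-trans z≤n m<L) (<⇒≤ m<L)) pps incr
       (later-primes-∤ (suc e) fs p-prime pps p<fs fs∤m) weak)
  where
  instance _ = prime⇒nonZero p-prime
  p≤1+L : p ≤ suc L
  p≤1+L = ≤-trans p≤m+2 (≤-trans (≤-reflexive (+-comm m 2)) (s≤s m<L))
  rep′ : RepresentsUpTo (m * p ^ suc e) (geomSum L p (suc e))
  rep′ = extend-by-prime-power p∤m p≤1+L rep (suc e)

increasing-pairwise : ∀ {fs} → Linked Increasing fs → AllPairs Increasing fs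
increasing-pairwise = Linked⇒AllPairs (λ {x} {y} {z} → <-trans {proj₁ x} {proj₁ y} {proj₁ z})

first-prime-is-two : ∀ {p e fs} → 2 ∣ primePowerProduct ((p , e) ∷ fs) →
  All PrimePower ((p , e) ∷ fs) → Linked Increasing ((p , e) ∷ fs) → p ≡ 2
first-prime-is-two 2∣n pps@((p-prime , _) ∷ _) linked =
  ≤-antisym (least-prime-divisor prime[2] 2∣n pps (increasing-pairwise linked))
            (nonTrivial⇒n>1 _ {{prime⇒nonTrivial p-prime}})

two-power-below-range : ∀ e → 1 ≤ e → 1 * 2 ^ e < geomSum 1 2 e
two-power-below-range (suc e) _ = geomSum-> 2 e ≤-refl ≤-refl

lemma3p5 : (n : ℕ) → 2 ∣ n → WeaklyPhiPractical n → Practical n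
lemma3p5 n 2∣n (_ , [] , (_ , _ , refl) , _) = contradiction 2∣n (prime∤1 prime[2])
lemma3p5 n 2∣n (1≤n , (p , e) ∷ fs , (pps@((_ , 1≤e) ∷ fs-pps) , linked , refl) , (_ , weak))
  with refl ← first-prime-is-two 2∣n pps linked
  = 1≤n , λ t _ → subst (λ k → RepresentsUpTo k k) drop-one represents-n t
  where
  two-power : RepresentsUpTo (1 * 2 ^ e) (geomSum 1 2 e)
  two-power = extend-by-prime-power (prime∤1 prime[2]) ≤-refl one-representsUpTo-one e
  represents-n : RepresentsUpTo (1 * 2 ^ e * primePowerProduct fs) (1 * 2 ^ e * primePowerProduct fs)
  represents-n with 2<fs ∷ fs-incr ← increasing-pairwise linked =
    extend-along fs two-power (two-power-below-range e 1≤e) fs-pps fs-incr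
      (later-primes-∤ e fs prime[2] fs-pps 2<fs (All.map (λ q-pp → prime∤1 (proj₁ q-pp)) fs-pps)) weak
  drop-one : 1 * 2 ^ e * primePowerProduct fs ≡ 2 ^ e * primePowerProduct fs
  drop-one = cong (_* primePowerProduct fs) (*-identityˡ (2 ^ e))
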